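{- Let $\mathcal{M}=(\mathbb{Z}_n,\mathcal{B})$ be a cyclic $k$-matroid, and for $j\in\mathbb{Z}_n$ let $B_j=\{j,j+1,\ldots,j+k-1\}$ (modulo $n$), so $B_0=\{0,1,\ldots,k-1\}$. Then there are at least $m_1(n,k)$ distinct bases in $\mathcal{B}$ of the form $(B_0\setminus Q)\cup P$, where $Q\subseteq B_0$ and $P\subseteq B_i$ for some $1\le i\le n-1$, where $$m_1(n,k)=1+\sum_{\Delta=0}^{\min(k-1,\,n-k-1)}\ \sum_{r=1}^{\Delta+1}(k-\Delta)\binom{\Delta-1}{r-2}\left(\left\lfloor\frac{n-k-\Delta-1}{k-r+1}\right\rfloor+1\right).$$
   Context: The ground set is $\mathbb{Z}_n=\{0,1,\ldots,n-1\}$ with arithmetic modulo $n$; for $s\in\mathbb{Z}_n$ and $A\subseteq\mathbb{Z}_n$, $s+A=\{s+a:a\in A\}$. A matroid $\mathcal{M}=(\mathbb{Z}_n,\mathcal{B})$ (given by its set of bases $\mathcal{B}$) is a cyclic $k$-matroid if it has rank $k$ and $A\in\mathcal{B}$ implies $s+A\in\mathcal{B}$ for all $s\in\mathbb{Z}_n$. Binomial coefficient convention: $\binom{a}{ -1}=0$ if $a\ge 0$ and $\binom{ -1}{ -1}=1$; other binomial coefficients are the usual ones for $a\ge 0$. -}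

module Defs where

open import Data.Nat using (ℕ; zero; suc; _+_; _*_; _∸_; _⊓_; _≤_; _<ᵇ_)
open import Data.Nat.DivMod using (_mod_; _/_)
open import Data.Nat.Combinatorics using (_C_)
open import Data.Integer as ℤ using (ℤ; +_; -[1+_])
open import Data.Fin using (Fin; toℕ)
open import Data.Fin.Subset using (Subset; _∈_; _∉_; _─_; _∪_; ⁅_⁆; ∣_∣)
open import Data.Vec using (tabulate; lookup)
open import Data.List using (List; map; upTo)
open import Data.Nat.ListAction using (sum)
open import Data.Product using (∃; _×_)
open import Relation.Binary.PropositionalEquality using (_≡_)

-- Arithmetic in ℤ_n = Fin n (n ≥ 1 whenever Fin n is inhabited).
_⊕_ : ∀ {n} → Fin n → Fin n → Fin n
_⊕_ {suc m} a b = (toℕ a + toℕ b) mod (suc m)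

_⊖_ : ∀ {n} → Fin n → Fin n → Fin n
_⊖_ {suc m} a b = (toℕ a + (suc m ∸ toℕ b)) mod (suc m)

-- s + A = { s + a : a ∈ A }, i.e. x ∈ s + A  iff  x - s ∈ A.
shift : ∀ {n} → Fin n → Subset n → Subset n
shift s A = tabulate (λ x → lookup A (x ⊖ s))

record Matroid (n : ℕ) : Set₁ where
  field
    IsBase    : Subset n → Set
    nonempty  : ∃ IsBase
    exchange  : ∀ B₁ B₂ → IsBase B₁ → IsBase B₂ →
                ∀ x → x ∈ B₁ → x ∉ B₂ →
                ∃ λ y → y ∈ B₂ × y ∉ B₁ × IsBase ((B₁ ─ ⁅ x ⁆) ∪ ⁅ y ⁆)

record IsCyclicMatroid {n : ℕ} (k : ℕ) (M : Matroid n) : Set where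
  open Matroid M
  field
    rank   : ∀ B → IsBase B → ∣ B ∣ ≡ k
    cyclic : ∀ (s : Fin n) B → IsBase B → IsBase (shift s B)

B₀ : ∀ {n} → ℕ → Subset n
B₀ k = tabulate (λ x → toℕ x <ᵇ k)

Bint : ∀ {n} → ℕ → Fin n → Subset n
Bint k j = shift j (B₀ k)

-- Binomial coefficient with the paper's convention:
-- C(a,b) usual for a,b ≥ 0;  C(a,-1) = 0 for a ≥ 0;  C(-1,-1) = 1.
-- (Other negative arguments never occur in m₁; set to 0.)
binomℤ : ℤ → ℤ → ℕ
binomℤ (+ a) (+ b) = a C b
binomℤ (+ a) -[1+ 0 ] = 0
binomℤ -[1+ 0 ] -[1+ 0 ] = 1
binomℤ _ _ = 0

-- For 0 ≤ k ≤ n the Δ-range has exactly min(k, n-k) elements.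
-- In range, n-k-Δ-1 ≥ 0 and k-r+1 ≥ 1, so ℕ subtraction is exact.
m₁ : ℕ → ℕ → ℕ
m₁ n k = 1 + sum (map (λ Δ → sum (map (λ r →
            (k ∸ Δ) * binomℤ (+ Δ ℤ.- + 1) (+ r ℤ.- + 2)
              * ((n ∸ k ∸ Δ ∸ 1) / suc (k ∸ r) + 1))
          (map suc (upTo (suc Δ)))))
        (upTo (k ⊓ (n ∸ k))))

open import Data.Fin.Subset using (_⊆_)
open import Data.Nat using (_<_)
HasForm : ∀ {n} → ℕ → Subset n → Set
HasForm {n} k B = ∃ λ (Q : Subset n) → ∃ λ (P : Subset n) → ∃ λ (i : Fin n) →
  1 ≤ toℕ i × Q ⊆ B₀ k × P ⊆ Bint k i × B ≡ (B₀ k ─ Q) ∪ P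

-- B₀ is a basis: by the augmentation property, an independent set of m + 1 elements together
-- with the independent shifts of B₀ m yields m + 1 consecutive independent elements, and
-- shifting those back gives B₀ (m + 1).
--
-- Let Q ⊆ B₀ have minimum x, maximum x + Δ and r elements, and let the window B_w start after
-- x + Δ without wrapping around onto x. Completing B₀ ∖ Q to a basis inside (B₀ ∖ Q) ∪ B_w gives
-- a basis B of the required form with B₀ ∖ B = Q. Windows whose starts differ by at least
-- k − r + 1 give different bases: two equal ones would lie in (B₀ ∖ Q) ∪ (B_w ∩ B_w′), which has
-- at most (k − r) + (r − 1) elements. There are k − Δ choices of x, C(Δ − 1, r − 2) choices of
-- the rest of Q and ⌊(n − k − Δ − 1)/(k − r + 1)⌋ + 1 windows; adding B₀ itself gives m₁(n, k).

module Submission where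

open import Defs
open import Data.Bool using (Bool; true; false; _∧_)
open import Data.Bool.Properties using (T-≡; T-∧)
open import Data.Empty using (⊥-elim)
open import Data.Fin as Fin using (Fin; toℕ)
open import Data.Fin.Properties using (toℕ-fromℕ<; toℕ-injective; toℕ<n)
open import Data.Fin.Subset using (Subset; inside; outside; _∈_; _∉_; _⊆_; _⊂_; _∪_; _∩_; _─_; ⁅_⁆; ∣_∣; ⊥; Nonempty)
open import Data.Fin.Subset.Properties
open import Data.Integer as ℤ using ()
open import Data.List as List using (List; []; _∷_; _++_; [_]; _∷ʳ_; map; concatMap; length; replicate; applyUpTo; upTo)
open import Data.List.Membership.Propositional using () renaming (_∈_ to _∈ˡ_)
open import Data.List.Membership.Propositional.Properties using (∈-map⁻)
open import Data.List.Properties using (length-++; length-map; ++-assoc; ∷-injectiveʳ; ∷ʳ-injectiveˡ; map-cong; length-applyUpTo; length-upTo)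
open import Data.List.Relation.Unary.All as All using (All; []; _∷_)
open import Data.List.Relation.Unary.All.Properties as All using ()
open import Data.List.Relation.Unary.AllPairs using ([]; _∷_)
open import Data.List.Relation.Unary.Unique.Propositional using (Unique)
open import Data.List.Relation.Unary.Unique.Propositional.Properties as Unique using ()
open import Data.Nat as ℕ using (ℕ; zero; suc; _+_; _*_; _∸_; _⊓_; _<_; _≤_; _<ᵇ_; _≤ᵇ_; z≤n; s≤s; _%_; _/_)
open import Data.Nat.Combinatorics using (_C_; nCk+nC[k+1]≡[n+1]C[k+1])
open import Data.Nat.DivMod using (_mod_; [m+n]%n≡m%n; m<n⇒m%n≡m; n%n≡0; m/n*n≤m)
open import Data.Nat.Induction using (<-wellFounded)
open import Data.Nat.ListAction using (sum)
open import Data.Nat.Properties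
open import Data.Nat.Tactic.RingSolver using (solve-∀)
open import Data.Product as Product using (∃; ∃-syntax; _×_; _,_; proj₁; proj₂)
open import Data.Sum using (_⊎_; inj₁; inj₂)
open import Data.Vec as Vec using (Vec; []; _∷_; here; there; tabulate; toList)
open import Data.Vec.Properties using (lookup∘tabulate; []=⇒lookup; lookup⇒[]=)
open import Function using (_∘_; id; Equivalence)
open import Induction.WellFounded using (Acc; acc)
open import Relation.Nullary using (¬_; yes; no; contradiction)
open import Relation.Binary.PropositionalEquality hiding ([_])

m⊓n∸o+[m∸n]≡m∸o : ∀ m {n o} → o ≤ n → m ⊓ n ∸ o + (m ∸ n) ≡ m ∸ o
m⊓n∸o+[m∸n]≡m∸o m {n} {o} o≤n with ≤-total m n
... | inj₁ m≤n = trans (cong₂ (λ a b → a ∸ o + b) (m≤n⇒m⊓n≡m m≤n) (m≤n⇒m∸n≡0 m≤n)) (+-identityʳ _)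
... | inj₂ n≤m = begin
  m ⊓ n ∸ o + (m ∸ n)   ≡⟨ cong (λ a → a ∸ o + (m ∸ n)) (m≥n⇒m⊓n≡n n≤m) ⟩
  n ∸ o + (m ∸ n)       ≡⟨ +-∸-comm (m ∸ n) o≤n ⟨
  n + (m ∸ n) ∸ o       ≡⟨ cong (_∸ o) (m+[n∸m]≡n n≤m) ⟩
  m ∸ o                 ∎
  where open ≡-Reasoning

m∸[1+m∸n]<n : ∀ {m n} → 1 ≤ n → n ≤ m → m ∸ suc (m ∸ n) < n
m∸[1+m∸n]<n {m} {suc n} _ n<m = begin-strict
  m ∸ suc (m ∸ suc n)        ≡⟨ cong (m ∸_) (+-comm 1 (m ∸ suc n)) ⟩
  m ∸ (m ∸ suc n + 1)        ≡⟨ ∸-+-assoc m (m ∸ suc n) 1 ⟨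
  m ∸ (m ∸ suc n) ∸ 1        ≡⟨ cong (_∸ 1) (m∸[m∸n]≡n n<m) ⟩
  n                          <⟨ ≤-refl ⟩
  suc n                      ∎
  where open ≤-Reasoning

-- Subsets of Fin n

x∈p─q⇒x∉q : ∀ {n} {x : Fin n} (p q : Subset n) → x ∈ p ─ q → x ∉ q
x∈p─q⇒x∉q (inside ∷ p) (outside ∷ q) here ()
x∈p─q⇒x∉q (_ ∷ p) (_ ∷ q) (there x∈p─q) (there x∈q) = x∈p─q⇒x∉q p q x∈p─q x∈q

∣p∣≡∣p─q∣+∣p∩q∣ : ∀ {n} (p q : Subset n) → ∣ p ∣ ≡ ∣ p ─ q ∣ + ∣ p ∩ q ∣
∣p∣≡∣p─q∣+∣p∩q∣ []            []            = refl
∣p∣≡∣p─q∣+∣p∩q∣ (inside ∷ p)  (inside ∷ q)  = trans (cong suc (∣p∣≡∣p─q∣+∣p∩q∣ p q)) (sym (+-suc _ _))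
∣p∣≡∣p─q∣+∣p∩q∣ (inside ∷ p)  (outside ∷ q) = cong suc (∣p∣≡∣p─q∣+∣p∩q∣ p q)
∣p∣≡∣p─q∣+∣p∩q∣ (outside ∷ p) (inside ∷ q)  = ∣p∣≡∣p─q∣+∣p∩q∣ p q
∣p∣≡∣p─q∣+∣p∩q∣ (outside ∷ p) (outside ∷ q) = ∣p∣≡∣p─q∣+∣p∩q∣ p q

∣p∪q∣≤∣p∣+∣q∣ : ∀ {n} (p q : Subset n) → ∣ p ∪ q ∣ ≤ ∣ p ∣ + ∣ q ∣
∣p∪q∣≤∣p∣+∣q∣ []            []            = z≤n
∣p∪q∣≤∣p∣+∣q∣ (inside ∷ p)  (s ∷ q)       = s≤s (≤-trans (∣p∪q∣≤∣p∣+∣q∣ p q) (+-monoʳ-≤ ∣ p ∣ (∣p∣≤∣x∷p∣ s q)))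
∣p∪q∣≤∣p∣+∣q∣ (outside ∷ p) (inside ∷ q)  = ≤-trans (s≤s (∣p∪q∣≤∣p∣+∣q∣ p q)) (≤-reflexive (sym (+-suc _ _)))
∣p∪q∣≤∣p∣+∣q∣ (outside ∷ p) (outside ∷ q) = ∣p∪q∣≤∣p∣+∣q∣ p q

x∉p⇒∣p∪⁅x⁆∣≡1+∣p∣ : ∀ {n} {x : Fin n} (p : Subset n) → x ∉ p → ∣ p ∪ ⁅ x ⁆ ∣ ≡ suc ∣ p ∣
x∉p⇒∣p∪⁅x⁆∣≡1+∣p∣ {x = Fin.zero}  (inside ∷ p)  x∉p = ⊥-elim (x∉p here)
x∉p⇒∣p∪⁅x⁆∣≡1+∣p∣ {x = Fin.zero}  (outside ∷ p) x∉p = cong (suc ∘ ∣_∣) (∪-identityʳ p)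
x∉p⇒∣p∪⁅x⁆∣≡1+∣p∣ {x = Fin.suc x} (inside ∷ p)  x∉p = cong suc (x∉p⇒∣p∪⁅x⁆∣≡1+∣p∣ p (x∉p ∘ there))
x∉p⇒∣p∪⁅x⁆∣≡1+∣p∣ {x = Fin.suc x} (outside ∷ p) x∉p = x∉p⇒∣p∪⁅x⁆∣≡1+∣p∣ p (x∉p ∘ there)

Nonempty[p─q]⇒p≢q : ∀ {n} {p q : Subset n} → Nonempty (p ─ q) → p ≢ q
Nonempty[p─q]⇒p≢q {p = p} {q} (x , x∈p─q) refl = x∈p─q⇒x∉q p q x∈p─q (p─q⊆p p q x∈p─q)

p⊆q∧∣q∣≤∣p∣⇒p≡q : ∀ {n} {p q : Subset n} → p ⊆ q → ∣ q ∣ ≤ ∣ p ∣ → p ≡ q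
p⊆q∧∣q∣≤∣p∣⇒p≡q {p = p} {q} p⊆q ∣q∣≤∣p∣ = ⊆-antisym p⊆q q⊆p
  where
  q⊆p : q ⊆ p
  q⊆p {x} x∈q with x ∈? p
  ... | yes x∈p = x∈p
  ... | no  x∉p = contradiction ∣q∣≤∣p∣ (<⇒≱ (p⊂q⇒∣p∣<∣q∣ (p⊆q , x , x∈q , x∉p)))

p⊆q⇒q≡p∪[q─p] : ∀ {n} {p q : Subset n} → p ⊆ q → q ≡ p ∪ (q ─ p)
p⊆q⇒q≡p∪[q─p] {p = p} {q} p⊆q = ⊆-antisym q⊆ ⊆q
  where
  q⊆ : q ⊆ p ∪ (q ─ p)
  q⊆ {x} x∈q with x ∈? p
  ... | yes x∈p = p⊆p∪q (q ─ p) x∈p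
  ... | no  x∉p = q⊆p∪q p (q ─ p) (x∈p∧x∉q⇒x∈p─q x∈q x∉p)
  ⊆q : p ∪ (q ─ p) ⊆ q
  ⊆q x∈ with x∈p∪q⁻ p (q ─ p) x∈
  ... | inj₁ x∈p   = p⊆q x∈p
  ... | inj₂ x∈q─p = p─q⊆p q p x∈q─p

InRange : ∀ {n} → ℕ → ℕ → Fin n → Set
InRange a b y = a ≤ toℕ y × toℕ y < b

InRange-pred : ∀ {n a b} {y : Fin n} → InRange a b (Fin.suc y) → InRange (a ∸ 1) (b ∸ 1) y
InRange-pred (a≤1+y , 1+y<b) = ∸-monoˡ-≤ 1 a≤1+y , ∸-monoˡ-≤ 1 1+y<b

∣p∣≤b∸a : ∀ {n} (p : Subset n) {a b} → (∀ {y} → y ∈ p → InRange a b y) → ∣ p ∣ ≤ b ∸ a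
∣p∣≤b∸a []            bounds = z≤n
∣p∣≤b∸a (outside ∷ p) {a} {b} bounds =
  ≤-trans (∣p∣≤b∸a p (InRange-pred ∘ bounds ∘ there)) (pred-width a)
  where
  pred-width : ∀ a → b ∸ 1 ∸ (a ∸ 1) ≤ b ∸ a
  pred-width zero    = m∸n≤m b 1
  pred-width (suc a) = ≤-reflexive (∸-+-assoc b 1 a)
∣p∣≤b∸a (inside ∷ p)  {a} {b} bounds with bounds here
... | z≤n , s≤s _ = s≤s (∣p∣≤b∸a p (InRange-pred ∘ bounds ∘ there))

b∸a≤∣p∣ : ∀ {n} (p : Subset n) {a b} → b ≤ n → (∀ {y} → InRange a b y → y ∈ p) → b ∸ a ≤ ∣ p ∣
b∸a≤∣p∣ p       {a}     {zero}  _          _       = ≤-trans (≤-reflexive (0∸n≡0 a)) z≤n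
b∸a≤∣p∣ (s ∷ p) {zero}  {suc b} (s≤s b≤n) inRange with inRange (z≤n , s≤s z≤n)
... | here = s≤s (b∸a≤∣p∣ p {0} b≤n (λ (_ , y<b) → drop-there (inRange (z≤n , s≤s y<b))))
b∸a≤∣p∣ (s ∷ p) {suc a} {suc b} (s≤s b≤n) inRange =
  ≤-trans (b∸a≤∣p∣ p b≤n (λ (a≤y , y<b) → drop-there (inRange (s≤s a≤y , s≤s y<b)))) (∣p∣≤∣x∷p∣ s p)

∈-tabulate⁺ : ∀ {n} {f : Fin n → Bool} {y} → f y ≡ true → y ∈ tabulate f
∈-tabulate⁺ {f = f} {y} fy = lookup⇒[]= y (tabulate f) (trans (lookup∘tabulate f y) fy)

∈-tabulate⁻ : ∀ {n} {f : Fin n → Bool} {y} → y ∈ tabulate f → f y ≡ true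
∈-tabulate⁻ {f = f} {y} y∈ = trans (sym (lookup∘tabulate f y)) ([]=⇒lookup y∈)

∈B₀⁺ : ∀ {n} k {y : Fin n} → toℕ y < k → y ∈ B₀ k
∈B₀⁺ k y<k = ∈-tabulate⁺ (Equivalence.to T-≡ (<⇒<ᵇ y<k))

∈B₀⁻ : ∀ {n} k {y : Fin n} → y ∈ B₀ k → toℕ y < k
∈B₀⁻ k y∈ = <ᵇ⇒< _ k (Equivalence.from T-≡ (∈-tabulate⁻ y∈))

interval : ∀ {n} → ℕ → ℕ → Subset n
interval a len = tabulate (λ y → (a ≤ᵇ toℕ y) ∧ (toℕ y <ᵇ a + len))

∈interval⁺ : ∀ {n} a len {y : Fin n} → InRange a (a + len) y → y ∈ interval a len
∈interval⁺ a len (a≤y , y<) = ∈-tabulate⁺ (Equivalence.to T-≡ (Equivalence.from T-∧ (≤⇒≤ᵇ a≤y , <⇒<ᵇ y<)))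

∈interval⁻ : ∀ {n} a len {y : Fin n} → y ∈ interval a len → InRange a (a + len) y
∈interval⁻ a len {y} y∈ with Equivalence.to T-∧ (Equivalence.from T-≡ (∈-tabulate⁻ y∈))
... | a≤y , y< = ≤ᵇ⇒≤ a (toℕ y) a≤y , <ᵇ⇒< (toℕ y) (a + len) y<

-- Cyclic shifts and windows

∈shift⁺ : ∀ {n} (s : Fin n) (A : Subset n) {y} → y ⊖ s ∈ A → y ∈ shift s A
∈shift⁺ s A y⊖s∈A = ∈-tabulate⁺ ([]=⇒lookup y⊖s∈A)

∈shift⁻ : ∀ {n} (s : Fin n) (A : Subset n) {y} → y ∈ shift s A → y ⊖ s ∈ A
∈shift⁻ s A {y} y∈ = lookup⇒[]= (y ⊖ s) A (∈-tabulate⁻ y∈)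

shift-mono : ∀ {n} (s : Fin n) {X Y : Subset n} → X ⊆ Y → shift s X ⊆ shift s Y
shift-mono s {X} {Y} X⊆Y = ∈shift⁺ s Y ∘ X⊆Y ∘ ∈shift⁻ s X

toℕ-mod : ∀ {n a} → a < suc n → toℕ (a mod suc n) ≡ a
toℕ-mod a<n = trans (toℕ-fromℕ< _) (m<n⇒m%n≡m a<n)

toℕ-⊖-≥ : ∀ {n} (y s : Fin (suc n)) → toℕ s ≤ toℕ y → toℕ (y ⊖ s) ≡ toℕ y ∸ toℕ s
toℕ-⊖-≥ {n} y s s≤y = begin
  toℕ (y ⊖ s)                       ≡⟨ toℕ-fromℕ< _ ⟩
  (toℕ y + (suc n ∸ toℕ s)) % suc n ≡⟨ cong (_% suc n) (sym (+-∸-assoc (toℕ y) (<⇒≤ (toℕ<n s)))) ⟩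
  (toℕ y + suc n ∸ toℕ s) % suc n   ≡⟨ cong (_% suc n) (+-∸-comm (suc n) s≤y) ⟩
  (toℕ y ∸ toℕ s + suc n) % suc n   ≡⟨ [m+n]%n≡m%n (toℕ y ∸ toℕ s) (suc n) ⟩
  (toℕ y ∸ toℕ s) % suc n           ≡⟨ m<n⇒m%n≡m (≤-<-trans (m∸n≤m (toℕ y) (toℕ s)) (toℕ<n y)) ⟩
  toℕ y ∸ toℕ s                     ∎
  where open ≡-Reasoning

toℕ-⊖-< : ∀ {n} (y s : Fin (suc n)) → toℕ y < toℕ s → toℕ (y ⊖ s) ≡ toℕ y + (suc n ∸ toℕ s)
toℕ-⊖-< {n} y s y<s = trans (toℕ-fromℕ< _) (m<n⇒m%n≡m (begin-strict
  toℕ y + (suc n ∸ toℕ s) <⟨ +-monoˡ-< (suc n ∸ toℕ s) y<s ⟩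
  toℕ s + (suc n ∸ toℕ s) ≡⟨ m+[n∸m]≡n (<⇒≤ (toℕ<n s)) ⟩
  suc n                   ∎))
  where open ≤-Reasoning

toℕ-⊖-[n∸t] : ∀ {n} t (y : Fin (suc n)) → toℕ y + t < suc n → toℕ (y ⊖ ((suc n ∸ t) mod suc n)) ≡ toℕ y + t
toℕ-⊖-[n∸t] {n} zero y _ = begin
  toℕ (y ⊖ s)     ≡⟨ toℕ-⊖-≥ y s (subst (_≤ toℕ y) (sym s≡0) z≤n) ⟩
  toℕ y ∸ toℕ s   ≡⟨ cong (toℕ y ∸_) s≡0 ⟩
  toℕ y           ≡⟨ +-identityʳ (toℕ y) ⟨
  toℕ y + 0       ∎
  where
  open ≡-Reasoning
  s = (suc n ∸ 0) mod suc n
  s≡0 = trans (toℕ-fromℕ< _) (n%n≡0 (suc n))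
toℕ-⊖-[n∸t] {n} t@(suc _) y y+t<n = begin
  toℕ (y ⊖ s)                 ≡⟨ toℕ-⊖-< y s (subst (toℕ y <_) (sym s≡n∸t) (m+n≤o⇒m≤o∸n (suc (toℕ y)) y+t<n)) ⟩
  toℕ y + (suc n ∸ toℕ s)     ≡⟨ cong (λ c → toℕ y + (suc n ∸ c)) s≡n∸t ⟩
  toℕ y + (suc n ∸ (suc n ∸ t)) ≡⟨ cong (toℕ y +_) (m∸[m∸n]≡n (m+n≤o⇒n≤o (suc (toℕ y)) y+t<n)) ⟩
  toℕ y + t                   ∎
  where
  open ≡-Reasoning
  s = (suc n ∸ t) mod suc n
  s≡n∸t = toℕ-mod (∸-monoʳ-< (s≤s z≤n) (m+n≤o⇒n≤o (suc (toℕ y)) y+t<n))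

∈Bint⁻ : ∀ {n} k (i y : Fin (suc n)) → y ∈ Bint k i →
         toℕ i ≤ toℕ y × toℕ y < toℕ i + k ⊎ toℕ y < toℕ i × suc n + toℕ y < toℕ i + k
∈Bint⁻ {n} k i y y∈ with toℕ i ℕ.≤? toℕ y
... | yes i≤y = inj₁ (i≤y , (begin-strict
  toℕ y                     ≡⟨ m+[n∸m]≡n i≤y ⟨
  toℕ i + (toℕ y ∸ toℕ i)   <⟨ +-monoʳ-< (toℕ i) (subst (_< k) (toℕ-⊖-≥ y i i≤y) y⊖i<k) ⟩
  toℕ i + k                 ∎))
  where open ≤-Reasoning
        y⊖i<k = ∈B₀⁻ k (∈shift⁻ i (B₀ k) y∈)
... | no i≰y = inj₂ (y<i , (begin-strict
  suc n + toℕ y                       ≡⟨ cong (_+ toℕ y) (m+[n∸m]≡n (<⇒≤ (toℕ<n i))) ⟨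
  toℕ i + (suc n ∸ toℕ i) + toℕ y     ≡⟨ +-assoc (toℕ i) _ (toℕ y) ⟩
  toℕ i + ((suc n ∸ toℕ i) + toℕ y)   ≡⟨ cong (toℕ i +_) (+-comm _ (toℕ y)) ⟩
  toℕ i + (toℕ y + (suc n ∸ toℕ i))   <⟨ +-monoʳ-< (toℕ i) (subst (_< k) (toℕ-⊖-< y i y<i) y⊖i<k) ⟩
  toℕ i + k                           ∎))
  where open ≤-Reasoning
        y<i = ≰⇒> i≰y
        y⊖i<k = ∈B₀⁻ k (∈shift⁻ i (B₀ k) y∈)

Bint-avoids : ∀ {n} k (i : Fin (suc n)) {a b} → b < toℕ i → toℕ i + k ≤ suc n + a →
              ∀ {y} → y ∈ Bint k i → toℕ y < a ⊎ b < toℕ y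
Bint-avoids k i b<i i+k≤n+a {y} y∈ with ∈Bint⁻ k i y y∈
... | inj₁ (i≤y , _)    = inj₂ (<-≤-trans b<i i≤y)
... | inj₂ (_ , n+y<i+k) = inj₁ (+-cancelˡ-< _ _ _ (<-≤-trans n+y<i+k i+k≤n+a))

-- The elements below d = i + k − n form the part of Bᵢ that wraps around.
∣Bint∩Bint∣≤ : ∀ {n} k (i j : Fin (suc n)) → toℕ i ≤ toℕ j → toℕ j + k ≤ suc n + toℕ i →
               ∣ Bint k i ∩ Bint k j ∣ ≤ toℕ i + k ∸ toℕ j
∣Bint∩Bint∣≤ {n} k i j i≤j j+k≤n+i = begin
  ∣ A ∣                                 ≡⟨ ∣p∣≡∣p─q∣+∣p∩q∣ A (B₀ d) ⟩
  ∣ A ─ B₀ d ∣ + ∣ A ∩ B₀ d ∣           ≤⟨ +-mono-≤ (∣p∣≤b∸a (A ─ B₀ d) unwrapped) (∣p∣≤b∸a (A ∩ B₀ d) wrapped) ⟩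
  (toℕ i + k) ⊓ suc n ∸ toℕ j + d       ≡⟨ m⊓n∸o+[m∸n]≡m∸o (toℕ i + k) (<⇒≤ (toℕ<n j)) ⟩
  toℕ i + k ∸ toℕ j                     ∎
  where
  open ≤-Reasoning
  A = Bint k i ∩ Bint k j
  d = toℕ i + k ∸ suc n
  wrapped : ∀ {y} → y ∈ A ∩ B₀ d → InRange 0 d y
  wrapped y∈ = z≤n , ∈B₀⁻ d (p∩q⊆q A (B₀ d) y∈)
  unwrapped : ∀ {y} → y ∈ A ─ B₀ d → InRange (toℕ j) ((toℕ i + k) ⊓ suc n) y
  unwrapped {y} y∈ with x∈p∩q⁻ (Bint k i) (Bint k j) (p─q⊆p A (B₀ d) y∈)
  ... | y∈i , y∈j with ∈Bint⁻ k i y y∈i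
  ...   | inj₂ (_ , n+y<i+k) =
          contradiction (∈B₀⁺ d (m+n≤o⇒m≤o∸n (suc (toℕ y)) (subst (_≤ toℕ i + k) (cong suc (+-comm (suc n) (toℕ y))) n+y<i+k))) (x∈p─q⇒x∉q A (B₀ d) y∈)
  ...   | inj₁ (i≤y , y<i+k) with ∈Bint⁻ k j y y∈j
  ...     | inj₁ (j≤y , _) = j≤y , ⊓-glb y<i+k (toℕ<n y)
  ...     | inj₂ (_ , n+y<j+k) = contradiction i≤y (<⇒≱ (+-cancelˡ-< (suc n) _ _ (<-≤-trans n+y<j+k j+k≤n+i)))

module Bases {n} (M : Matroid n) where
  open Matroid M

  Independent : Subset n → Set
  Independent X = ∃[ B ] IsBase B × X ⊆ B

  Independent-⊆ : ∀ {X Y} → X ⊆ Y → Independent Y → Independent X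
  Independent-⊆ X⊆Y (B , b , Y⊆B) = B , b , Y⊆B ∘ X⊆Y

  exchange-step : ∀ {I B₁ B₂} → IsBase B₁ → I ⊆ B₁ → IsBase B₂ → ∀ {x} → x ∈ B₁ ─ (I ∪ B₂) →
                  ∃[ B ] IsBase B × I ⊆ B × B ─ (I ∪ B₂) ⊂ B₁ ─ (I ∪ B₂)
  exchange-step {I} {B₁} {B₂} b₁ I⊆B₁ b₂ {x} x∈D = B , b , I⊆B , (D′⊆D , x , x∈D , x∉D′)
    where
    x∈B₁ = p─q⊆p B₁ (I ∪ B₂) x∈D
    x∉I∪B₂ = x∈p─q⇒x∉q B₁ (I ∪ B₂) x∈D
    swap = exchange B₁ B₂ b₁ b₂ x x∈B₁ (x∉I∪B₂ ∘ q⊆p∪q I B₂)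
    y = proj₁ swap
    y∈B₂ = proj₁ (proj₂ swap)
    y∉B₁ = proj₁ (proj₂ (proj₂ swap))
    b = proj₂ (proj₂ (proj₂ swap))
    B = (B₁ ─ ⁅ x ⁆) ∪ ⁅ y ⁆
    I⊆B : I ⊆ B
    I⊆B z∈I = p⊆p∪q ⁅ y ⁆ (x∈p∧x∉q⇒x∈p─q (I⊆B₁ z∈I)
      (λ z∈⁅x⁆ → x∉I∪B₂ (p⊆p∪q B₂ (subst (_∈ I) (x∈⁅y⁆⇒x≡y x z∈⁅x⁆) z∈I))))
    D′⊆D : B ─ (I ∪ B₂) ⊆ B₁ ─ (I ∪ B₂)
    D′⊆D z∈D′ with x∈p∪q⁻ (B₁ ─ ⁅ x ⁆) ⁅ y ⁆ (p─q⊆p B (I ∪ B₂) z∈D′)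
    ... | inj₁ z∈B₁─x = x∈p∧x∉q⇒x∈p─q (p─q⊆p B₁ ⁅ x ⁆ z∈B₁─x) (x∈p─q⇒x∉q B (I ∪ B₂) z∈D′)
    ... | inj₂ z∈⁅y⁆  = contradiction (q⊆p∪q I B₂ (subst (_∈ B₂) (sym (x∈⁅y⁆⇒x≡y y z∈⁅y⁆)) y∈B₂))
                                      (x∈p─q⇒x∉q B (I ∪ B₂) z∈D′)
    x∉D′ : x ∉ B ─ (I ∪ B₂)
    x∉D′ x∈D′ with x∈p∪q⁻ (B₁ ─ ⁅ x ⁆) ⁅ y ⁆ (p─q⊆p B (I ∪ B₂) x∈D′)
    ... | inj₁ x∈B₁─x = x∈p─q⇒x∉q B₁ ⁅ x ⁆ x∈B₁─x (x∈⁅x⁆ x)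
    ... | inj₂ x∈⁅y⁆  = y∉B₁ (subst (_∈ B₁) (x∈⁅y⁆⇒x≡y y x∈⁅y⁆) x∈B₁)

  basis-extension : ∀ {I B₁ B₂} → IsBase B₁ → I ⊆ B₁ → IsBase B₂ →
                    ∃[ B ] IsBase B × I ⊆ B × B ⊆ I ∪ B₂
  basis-extension {I} {B₁} {B₂} b₁ I⊆B₁ b₂ = go B₁ b₁ I⊆B₁ (<-wellFounded ∣ B₁ ─ (I ∪ B₂) ∣)
    where
    go : ∀ B → IsBase B → I ⊆ B → Acc _<_ ∣ B ─ (I ∪ B₂) ∣ → ∃[ B ] IsBase B × I ⊆ B × B ⊆ I ∪ B₂
    go B b I⊆B (acc rec) with nonempty? (B ─ (I ∪ B₂))
    ... | yes (x , x∈D) =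
          let B′ , b′ , I⊆B′ , D′⊂D = exchange-step b I⊆B b₂ x∈D
          in go B′ b′ I⊆B′ (rec (p⊂q⇒∣p∣<∣q∣ D′⊂D))
    ... | no empty = B , b , I⊆B , B⊆I∪B₂
      where
      B⊆I∪B₂ : B ⊆ I ∪ B₂
      B⊆I∪B₂ {z} z∈B with z ∈? (I ∪ B₂)
      ... | yes z∈ = z∈
      ... | no  z∉ = contradiction (z , x∈p∧x∉q⇒x∈p─q z∈B z∉) empty

  module _ {k} (rank : ∀ B → IsBase B → ∣ B ∣ ≡ k) where

    augment : ∀ {I J} → Independent I → Independent J → ∣ I ∣ < ∣ J ∣ →
              ∃[ x ] x ∈ J × x ∉ I × Independent (I ∪ ⁅ x ⁆)
    augment {I} {J} (B₁ , b₁ , I⊆B₁) (B₂ , b₂ , J⊆B₂) ∣I∣<∣J∣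
      with basis-extension b₁ I⊆B₁ b₂
    ... | B , b , I⊆B , B⊆I∪B₂ with nonempty? ((B ∩ J) ─ I)
    ...   | yes (x , x∈) = x , p∩q⊆q B J (p─q⊆p (B ∩ J) I x∈) , x∈p─q⇒x∉q (B ∩ J) I x∈ , B , b , I∪x⊆B
      where
      I∪x⊆B : I ∪ ⁅ x ⁆ ⊆ B
      I∪x⊆B z∈ with x∈p∪q⁻ I ⁅ x ⁆ z∈
      ... | inj₁ z∈I   = I⊆B z∈I
      ... | inj₂ z∈⁅x⁆ = subst (_∈ B) (sym (x∈⁅y⁆⇒x≡y x z∈⁅x⁆)) (p∩q⊆p B J (p─q⊆p (B ∩ J) I x∈))
    ...   | no none = contradiction (+-cancelˡ-≤ ∣ B₂ ─ J ∣ _ _ (≤-trans B₂-count B-count)) (<⇒≱ ∣I∣<∣J∣)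
      where
      B─I⊆B₂─J : B ─ I ⊆ B₂ ─ J
      B─I⊆B₂─J {z} z∈ with x∈p∪q⁻ I B₂ (B⊆I∪B₂ (p─q⊆p B I z∈))
      ... | inj₁ z∈I  = contradiction z∈I (x∈p─q⇒x∉q B I z∈)
      ... | inj₂ z∈B₂ = x∈p∧x∉q⇒x∈p─q z∈B₂ (λ z∈J →
                          none (z , x∈p∧x∉q⇒x∈p─q (x∈p∩q⁺ (p─q⊆p B I z∈ , z∈J)) (x∈p─q⇒x∉q B I z∈)))
      B₂-count : ∣ B₂ ─ J ∣ + ∣ J ∣ ≤ k
      B₂-count = begin
        ∣ B₂ ─ J ∣ + ∣ J ∣       ≤⟨ +-monoʳ-≤ ∣ B₂ ─ J ∣ (p⊆q⇒∣p∣≤∣q∣ (λ z∈J → x∈p∩q⁺ (J⊆B₂ z∈J , z∈J))) ⟩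
        ∣ B₂ ─ J ∣ + ∣ B₂ ∩ J ∣  ≡⟨ ∣p∣≡∣p─q∣+∣p∩q∣ B₂ J ⟨
        ∣ B₂ ∣                   ≡⟨ rank B₂ b₂ ⟩
        k                        ∎
        where open ≤-Reasoning
      B-count : k ≤ ∣ B₂ ─ J ∣ + ∣ I ∣
      B-count = begin
        k                        ≡⟨ rank B b ⟨
        ∣ B ∣                    ≡⟨ ∣p∣≡∣p─q∣+∣p∩q∣ B I ⟩
        ∣ B ─ I ∣ + ∣ B ∩ I ∣    ≤⟨ +-mono-≤ (p⊆q⇒∣p∣≤∣q∣ B─I⊆B₂─J) (∣p∩q∣≤∣q∣ B I) ⟩
        ∣ B₂ ─ J ∣ + ∣ I ∣       ∎
        where open ≤-Reasoning

module Cyclic {n k} {M : Matroid (suc n)} (CM : IsCyclicMatroid k M) where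
  open Matroid M
  open IsCyclicMatroid CM
  open Bases M

  Independent-shift : ∀ s {X} → Independent X → Independent (shift s X)
  Independent-shift s (B , b , X⊆B) = shift s B , cyclic s B b , shift-mono s X⊆B

  interval⊆shift-B₀ : ∀ {a} len → a < suc n → interval a len ⊆ shift (a mod suc n) (B₀ len)
  interval⊆shift-B₀ {a} len a<n {y} y∈ = ∈shift⁺ s (B₀ len) (∈B₀⁺ len (begin-strict
    toℕ (y ⊖ s)      ≡⟨ toℕ-⊖-≥ y s (subst (_≤ toℕ y) (sym s≡a) a≤y) ⟩
    toℕ y ∸ toℕ s    ≡⟨ cong (toℕ y ∸_) s≡a ⟩
    toℕ y ∸ a        <⟨ ∸-monoˡ-< y<a+len a≤y ⟩
    a + len ∸ a      ≡⟨ m+n∸m≡n a len ⟩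
    len              ∎))
    where
    open ≤-Reasoning
    s = a mod suc n
    s≡a = toℕ-mod a<n
    a≤y = proj₁ (∈interval⁻ a len y∈)
    y<a+len = proj₂ (∈interval⁻ a len y∈)

  B₀⊆shift-interval : ∀ t len → t + len ≤ suc n → B₀ len ⊆ shift ((suc n ∸ t) mod suc n) (interval t len)
  B₀⊆shift-interval t len t+len≤n {y} y∈ =
    ∈shift⁺ ((suc n ∸ t) mod suc n) (interval t len) (∈interval⁺ t len (subst (λ v → t ≤ v × v < t + len) (sym y⊖s≡y+t)
      (m≤n+m t (toℕ y) , subst (_< t + len) (+-comm t (toℕ y)) (+-monoʳ-< t y<len))))
    where
    y<len = ∈B₀⁻ len y∈
    y⊖s≡y+t = toℕ-⊖-[n∸t] t y (<-≤-trans (subst (_< t + len) (+-comm t (toℕ y)) (+-monoʳ-< t y<len)) t+len≤n)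

  -- Augment the m-interval ending just below top from I: either the new element is top, which
  -- extends the interval, or it lies below top and the search continues with a smaller bound.
  interval-grows : ∀ m → (∀ a → a < suc n → Independent (interval a m)) →
                   ∀ top {I} → top ≤ suc n → Independent I → (∀ {y} → y ∈ I → toℕ y < top) → suc m ≤ ∣ I ∣ →
                   ∃[ t ] t + m < suc n × Independent (interval t (suc m))
  interval-grows m windows zero {I} _ _ I<0 m<∣I∣ =
    contradiction (∣p∣≤b∸a I (λ y∈ → z≤n , I<0 y∈)) (<⇒≱ (<-≤-trans (s≤s z≤n) m<∣I∣))
  interval-grows m windows (suc top) {I} top<n indI I<top m<∣I∣ =
    grow (augment rank indK indI (≤-<-trans ∣K∣≤m m<∣I∣))
    where
    m≤top : m ≤ top
    m≤top = ≤-pred (≤-trans m<∣I∣ (∣p∣≤b∸a I (λ y∈ → z≤n , I<top y∈)))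
    a = top ∸ m
    a+m≡top : a + m ≡ top
    a+m≡top = m∸n+n≡m m≤top
    K = interval a m
    indK : Independent K
    indK = windows a (≤-<-trans (m∸n≤m top m) top<n)
    ∣K∣≤m : ∣ K ∣ ≤ m
    ∣K∣≤m = subst (∣ K ∣ ≤_) (m+n∸m≡n a m) (∣p∣≤b∸a K (∈interval⁻ a m))
    m≤∣K∣ : m ≤ ∣ K ∣
    m≤∣K∣ = subst (_≤ ∣ K ∣) (m+n∸m≡n a m)
              (b∸a≤∣p∣ K (subst (_≤ suc n) (sym a+m≡top) (<⇒≤ top<n)) (∈interval⁺ a m))
    grow : ∃[ x ] x ∈ I × x ∉ K × Independent (K ∪ ⁅ x ⁆) → ∃[ t ] t + m < suc n × Independent (interval t (suc m))
    grow (x , x∈I , x∉K , indK∪x) with toℕ x ℕ.≟ top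
    ... | yes x≡top = a , subst (_< suc n) (sym a+m≡top) top<n , Independent-⊆ interval⊆K∪x indK∪x
      where
      interval⊆K∪x : interval a (suc m) ⊆ K ∪ ⁅ x ⁆
      interval⊆K∪x {z} z∈ with ∈interval⁻ a (suc m) z∈ | toℕ z ℕ.<? a + m
      ... | a≤z , _     | yes z<a+m = p⊆p∪q ⁅ x ⁆ (∈interval⁺ a m (a≤z , z<a+m))
      ... | _ , z<a+m+1 | no z≮a+m  = q⊆p∪q K ⁅ x ⁆ (subst (_∈ ⁅ x ⁆) (toℕ-injective x≡z) (x∈⁅x⁆ x))
        where
        x≡z : toℕ x ≡ toℕ z
        x≡z = trans x≡top (trans (sym a+m≡top)
                (≤-antisym (≮⇒≥ z≮a+m) (≤-pred (subst (toℕ z <_) (+-suc a m) z<a+m+1))))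
    ... | no  x≢top = interval-grows m windows top (<⇒≤ top<n) indK∪x K∪x<top
                        (subst (suc m ≤_) (sym (x∉p⇒∣p∪⁅x⁆∣≡1+∣p∣ K x∉K)) (s≤s m≤∣K∣))
      where
      K∪x<top : ∀ {y} → y ∈ K ∪ ⁅ x ⁆ → toℕ y < top
      K∪x<top y∈ with x∈p∪q⁻ K ⁅ x ⁆ y∈
      ... | inj₁ y∈K   = subst (_ <_) a+m≡top (proj₂ (∈interval⁻ a m y∈K))
      ... | inj₂ y∈⁅x⁆ = subst (λ v → toℕ v < top) (sym (x∈⁅y⁆⇒x≡y x y∈⁅x⁆)) (≤∧≢⇒< (≤-pred (I<top x∈I)) x≢top)

  B₀-independent : ∀ m → m ≤ k → Independent (B₀ m)
  B₀-independent zero _ = proj₁ nonempty , proj₂ nonempty , λ y∈ → ⊥-elim (n≮0 (∈B₀⁻ 0 y∈))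
  B₀-independent (suc m) m<k =
    shifted (interval-grows m windows (suc n) ≤-refl basis (λ {y} _ → toℕ<n y)
                            (subst (suc m ≤_) (sym (rank _ (proj₂ nonempty))) m<k))
    where
    basis : Independent (proj₁ nonempty)
    basis = proj₁ nonempty , proj₂ nonempty , λ y∈ → y∈
    windows : ∀ a → a < suc n → Independent (interval a m)
    windows a a<n = Independent-⊆ (interval⊆shift-B₀ m a<n)
                      (Independent-shift (a mod suc n) (B₀-independent m (≤-trans (n≤1+n m) m<k)))
    shifted : ∃[ t ] t + m < suc n × Independent (interval t (suc m)) → Independent (B₀ (suc m))
    shifted (t , t+m<n , indT) =
      Independent-⊆ (B₀⊆shift-interval t (suc m) (subst (_≤ suc n) (sym (+-suc t m)) t+m<n))
                    (Independent-shift ((suc n ∸ t) mod suc n) indT)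

  k≤n : k ≤ suc n
  k≤n = subst (_≤ suc n) (rank _ (proj₂ nonempty)) (∣p∣≤n (proj₁ nonempty))

  B₀-isBase : IsBase (B₀ {suc n} k)
  B₀-isBase with B₀-independent k ≤-refl
  ... | B , b , B₀⊆B = subst IsBase (sym (p⊆q∧∣q∣≤∣p∣⇒p≡q B₀⊆B ∣B∣≤∣B₀∣)) b
    where
    ∣B∣≤∣B₀∣ : ∣ B ∣ ≤ ∣ B₀ {suc n} k ∣
    ∣B∣≤∣B₀∣ = subst (_≤ ∣ B₀ {suc n} k ∣) (sym (rank B b)) (b∸a≤∣p∣ (B₀ k) {0} k≤n (∈B₀⁺ k ∘ proj₂))

-- Lists and bit strings

All-concatMap⁺ : ∀ {A B : Set} {P : B → Set} (f : A → List B) {xs} → All (All P ∘ f) xs → All P (concatMap f xs)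
All-concatMap⁺ f = All.concat⁺ ∘ All.map⁺

Unique-concatMap⁺ : ∀ {A B : Set} (key : B → A) (f : A → List B) {xs} → Unique xs →
                    All (λ a → Unique (f a) × All (λ b → key b ≡ a) (f a)) xs → Unique (concatMap f xs)
Unique-concatMap⁺ key f {[]}     []             []                    = []
Unique-concatMap⁺ key f {a ∷ xs} (a∉xs ∷ uniq) ((fa-uniq , fa-keys) ∷ rest) =
  Unique.++⁺ fa-uniq (Unique-concatMap⁺ key f uniq rest)
    (λ (b∈fa , b∈rest) → All.lookup other-keys b∈rest (All.lookup fa-keys b∈fa))
  where
  other-keys : All (λ b → key b ≢ a) (concatMap f xs)
  other-keys = All-concatMap⁺ f (All.zipWith (λ (a≢a′ , (_ , keys)) → All.map (λ kb≡a′ kb≡a → a≢a′ (trans (sym kb≡a) kb≡a′)) keys) (a∉xs , rest))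

length-concatMap : ∀ {A B : Set} (f : A → List B) xs → length (concatMap f xs) ≡ sum (map (length ∘ f) xs)
length-concatMap f []       = refl
length-concatMap f (x ∷ xs) = trans (length-++ (f x)) (cong (length (f x) +_) (length-concatMap f xs))

length-concatMap-const : ∀ {A B : Set} (f : A → List B) {c} xs → (∀ a → length (f a) ≡ c) →
                         length (concatMap f xs) ≡ length xs * c
length-concatMap-const f []       _   = refl
length-concatMap-const f (x ∷ xs) len = trans (length-++ (f x)) (cong₂ _+_ (len x) (length-concatMap-const f xs len))

trues : List Bool → ℕ
trues []           = 0
trues (true ∷ bs)  = suc (trues bs)
trues (false ∷ bs) = trues bs

trues-++ : ∀ bs cs → trues (bs ++ cs) ≡ trues bs + trues cs
trues-++ []           cs = refl
trues-++ (true ∷ bs)  cs = cong suc (trues-++ bs cs)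
trues-++ (false ∷ bs) cs = trues-++ bs cs

choose : ℕ → ℕ → List (List Bool)
choose zero    zero    = [ [] ]
choose zero    (suc j) = []
choose (suc m) zero    = map (false ∷_) (choose m zero)
choose (suc m) (suc j) = map (true ∷_) (choose m j) ++ map (false ∷_) (choose m (suc j))

length-choose : ∀ m j → length (choose m j) ≡ m C j
length-choose zero    zero    = refl
length-choose zero    (suc j) = refl
length-choose (suc m) zero    = trans (length-map (false ∷_) (choose m zero)) (length-choose m zero)
length-choose (suc m) (suc j) = begin
  length (map (true ∷_) (choose m j) ++ map (false ∷_) (choose m (suc j)))
    ≡⟨ length-++ (map (true ∷_) (choose m j)) ⟩
  length (map (true ∷_) (choose m j)) + length (map (false ∷_) (choose m (suc j)))
    ≡⟨ cong₂ _+_ (length-map (true ∷_) (choose m j)) (length-map (false ∷_) (choose m (suc j))) ⟩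
  length (choose m j) + length (choose m (suc j))
    ≡⟨ cong₂ _+_ (length-choose m j) (length-choose m (suc j)) ⟩
  m C j + m C suc j
    ≡⟨ nCk+nC[k+1]≡[n+1]C[k+1] m j ⟩
  suc m C suc j ∎
  where open ≡-Reasoning

choose-sound : ∀ m j → All (λ bs → length bs ≡ m × trues bs ≡ j) (choose m j)
choose-sound zero    zero    = (refl , refl) ∷ []
choose-sound zero    (suc j) = []
choose-sound (suc m) zero    = All.map⁺ (All.map (λ (len , ts) → cong suc len , ts) (choose-sound m zero))
choose-sound (suc m) (suc j) = All.++⁺
  (All.map⁺ (All.map (λ (len , ts) → cong suc len , cong suc ts) (choose-sound m j)))
  (All.map⁺ (All.map (λ (len , ts) → cong suc len , ts) (choose-sound m (suc j))))

choose-unique : ∀ m j → Unique (choose m j)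
choose-unique zero    zero    = [] ∷ []
choose-unique zero    (suc j) = []
choose-unique (suc m) zero    = Unique.map⁺ ∷-injectiveʳ (choose-unique m zero)
choose-unique (suc m) (suc j) = Unique.++⁺ (Unique.map⁺ ∷-injectiveʳ (choose-unique m j))
                                           (Unique.map⁺ ∷-injectiveʳ (choose-unique m (suc j))) disjoint
  where
  disjoint : ∀ {bs} → ¬ (bs ∈ˡ map (true ∷_) (choose m j) × bs ∈ˡ map (false ∷_) (choose m (suc j)))
  disjoint (t∈ , f∈) with ∈-map⁻ (true ∷_) t∈ | ∈-map⁻ (false ∷_) f∈
  ... | _ , _ , refl | _ , _ , ()

NoTrailingFalse : List Bool → Set
NoTrailingFalse T = T ≡ [] ⊎ ∃[ S ] T ≡ S ∷ʳ true

Pattern : ℕ → ℕ → List Bool → Set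
Pattern Δ r T = length T ≡ Δ × suc (trues T) ≡ r × NoTrailingFalse T

-- T records which of x + 1, …, x + Δ lie in Q. Its last entry is true when Δ > 0, so only the
-- Δ − 1 interior entries are free, matching C(Δ − 1, r − 2) with C(−1, −1) = 1 for Δ = 0.
patterns : ℕ → ℕ → List (List Bool)
patterns zero    zero          = []
patterns zero    (suc zero)    = [ [] ]
patterns zero    (suc (suc r)) = []
patterns (suc Δ) zero          = []
patterns (suc Δ) (suc zero)    = []
patterns (suc Δ) (suc (suc j)) = map (_∷ʳ true) (choose Δ j)

patterns-sound : ∀ Δ r → All (Pattern Δ r) (patterns Δ r)
patterns-sound zero    zero          = []
patterns-sound zero    (suc zero)    = (refl , refl , inj₁ refl) ∷ []
patterns-sound zero    (suc (suc r)) = []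
patterns-sound (suc Δ) zero          = []
patterns-sound (suc Δ) (suc zero)    = []
patterns-sound (suc Δ) (suc (suc j)) = All.map⁺ (All.map (λ {S} → sound S) (choose-sound Δ j))
  where
  sound : ∀ S → length S ≡ Δ × trues S ≡ j → Pattern (suc Δ) (suc (suc j)) (S ∷ʳ true)
  sound S (len , ts) = trans (length-++ S) (trans (+-comm (length S) 1) (cong suc len))
                     , cong suc (trans (trues-++ S [ true ]) (trans (+-comm (trues S) 1) (cong suc ts)))
                     , inj₂ (S , refl)

patterns-unique : ∀ Δ r → Unique (patterns Δ r)
patterns-unique zero    zero          = []
patterns-unique zero    (suc zero)    = [] ∷ []
patterns-unique zero    (suc (suc r)) = []
patterns-unique (suc Δ) zero          = []
patterns-unique (suc Δ) (suc zero)    = []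
patterns-unique (suc Δ) (suc (suc j)) = Unique.map⁺ (∷ʳ-injectiveˡ _ _) (choose-unique Δ j)

length-patterns : ∀ Δ r → length (patterns Δ r) ≡ binomℤ (ℤ.+ Δ ℤ.- ℤ.+ 1) (ℤ.+ r ℤ.- ℤ.+ 2)
length-patterns zero    zero          = refl
length-patterns zero    (suc zero)    = refl
length-patterns zero    (suc (suc r)) = refl
length-patterns (suc Δ) zero          = refl
length-patterns (suc Δ) (suc zero)    = refl
length-patterns (suc Δ) (suc (suc j)) = trans (length-map (_∷ʳ true) (choose Δ j)) (length-choose Δ j)

bit : ℕ → List Bool → Bool
bit _       []       = false
bit zero    (b ∷ bs) = b
bit (suc i) (b ∷ bs) = bit i bs

bit⇒<length : ∀ i bs → bit i bs ≡ true → i < length bs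
bit⇒<length i       []       ()
bit⇒<length zero    (b ∷ bs) _  = s≤s z≤n
bit⇒<length (suc i) (b ∷ bs) eq = s≤s (bit⇒<length i bs eq)

pad : List Bool → (n : ℕ) → Vec Bool n
pad _        zero    = Vec.[]
pad []       (suc n) = false Vec.∷ pad [] n
pad (b ∷ bs) (suc n) = b Vec.∷ pad bs n

lookup-pad : ∀ bs n (y : Fin n) → Vec.lookup (pad bs n) y ≡ bit (toℕ y) bs
lookup-pad []       (suc n) Fin.zero    = refl
lookup-pad []       (suc n) (Fin.suc y) = lookup-pad [] n y
lookup-pad (b ∷ bs) (suc n) Fin.zero    = refl
lookup-pad (b ∷ bs) (suc n) (Fin.suc y) = lookup-pad bs n y

toList-pad : ∀ bs n → length bs ≤ n → toList (pad bs n) ≡ bs ++ replicate (n ∸ length bs) false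
toList-pad []       zero    _         = refl
toList-pad []       (suc n) _         = cong (false ∷_) (toList-pad [] n z≤n)
toList-pad (b ∷ bs) (suc n) (s≤s len) = cong (b ∷_) (toList-pad bs n len)

∣pad∣ : ∀ bs n → length bs ≤ n → ∣ pad bs n ∣ ≡ trues bs
∣pad∣ []           zero    _         = refl
∣pad∣ []           (suc n) _         = ∣pad∣ [] n z≤n
∣pad∣ (true ∷ bs)  (suc n) (s≤s len) = cong suc (∣pad∣ bs n len)
∣pad∣ (false ∷ bs) (suc n) (s≤s len) = ∣pad∣ bs n len

encode : ℕ → List Bool → List Bool
encode x T = replicate x false ++ true ∷ T

length-encode : ∀ x T → length (encode x T) ≡ x + suc (length T)
length-encode zero    T = refl
length-encode (suc x) T = cong suc (length-encode x T)

trues-encode : ∀ x T → trues (encode x T) ≡ suc (trues T)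
trues-encode zero    T = refl
trues-encode (suc x) T = trues-encode x T

bit-encode-start : ∀ x T → bit x (encode x T) ≡ true
bit-encode-start zero    T = refl
bit-encode-start (suc x) T = bit-encode-start x T

bit-encode : ∀ y x T → bit y (encode x T) ≡ true → x ≤ y × y ≤ x + length T
bit-encode y       zero    T eq = z≤n , ≤-pred (bit⇒<length y (true ∷ T) eq)
bit-encode zero    (suc x) T ()
bit-encode (suc y) (suc x) T eq = Product.map s≤s s≤s (bit-encode y x T eq)

splitAtFirstTrue : List Bool → ℕ × List Bool
splitAtFirstTrue []           = 0 , []
splitAtFirstTrue (true ∷ bs)  = 0 , bs
splitAtFirstTrue (false ∷ bs) = Product.map₁ suc (splitAtFirstTrue bs)

_∷ᵗ_ : Bool → List Bool → List Bool
b     ∷ᵗ (c ∷ cs) = b ∷ c ∷ cs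
false ∷ᵗ []       = []
true  ∷ᵗ []       = [ true ]

dropTrailingFalses : List Bool → List Bool
dropTrailingFalses []       = []
dropTrailingFalses (b ∷ bs) = b ∷ᵗ dropTrailingFalses bs

decode : List Bool → ℕ × List Bool
decode = Product.map₂ dropTrailingFalses ∘ splitAtFirstTrue

splitAtFirstTrue-encode : ∀ x T → splitAtFirstTrue (encode x T) ≡ (x , T)
splitAtFirstTrue-encode zero    T = refl
splitAtFirstTrue-encode (suc x) T = cong (Product.map₁ suc) (splitAtFirstTrue-encode x T)

dropTrailingFalses-padded : ∀ T a → NoTrailingFalse T → dropTrailingFalses (T ++ replicate a false) ≡ T
dropTrailingFalses-padded _ a (inj₁ refl)       = falses a
  where
  falses : ∀ a → dropTrailingFalses (replicate a false) ≡ []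
  falses zero    = refl
  falses (suc a) = cong (false ∷ᵗ_) (falses a)
dropTrailingFalses-padded _ a (inj₂ (S , refl)) = ends S
  where
  ends : ∀ S → dropTrailingFalses ((S ∷ʳ true) ++ replicate a false) ≡ S ∷ʳ true
  ends []           = cong (true ∷ᵗ_) (dropTrailingFalses-padded [] a (inj₁ refl))
  ends (b ∷ [])     = cong (b ∷ᵗ_) (ends [])
  ends (b ∷ c ∷ S)  = cong (b ∷ᵗ_) (ends (c ∷ S))

decode-encode : ∀ x T a → NoTrailingFalse T → decode (encode x T ++ replicate a false) ≡ (x , T)
decode-encode x T a ntf = begin
  decode (encode x T ++ replicate a false)
    ≡⟨ cong decode (++-assoc (replicate x false) (true ∷ T) (replicate a false)) ⟩
  decode (encode x (T ++ replicate a false))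
    ≡⟨ cong (Product.map₂ dropTrailingFalses) (splitAtFirstTrue-encode x (T ++ replicate a false)) ⟩
  x , dropTrailingFalses (T ++ replicate a false)
    ≡⟨ cong (x ,_) (dropTrailingFalses-padded T a ntf) ⟩
  x , T ∎
  where open ≡-Reasoning

module Construction {n k} {M : Matroid (suc n)} (CM : IsCyclicMatroid k M) where
  open Matroid M
  open IsCyclicMatroid CM
  open Bases M
  open Cyclic CM

  private
    extension : ∀ Q i → ∃[ B ] IsBase B × B₀ k ─ Q ⊆ B × B ⊆ (B₀ k ─ Q) ∪ Bint k i
    extension Q i = basis-extension B₀-isBase (p─q⊆p (B₀ k) Q) (cyclic i (B₀ k) B₀-isBase)

  completion : Subset (suc n) → Fin (suc n) → Subset (suc n)
  completion Q i = proj₁ (extension Q i)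

  completion-isBase : ∀ Q i → IsBase (completion Q i)
  completion-isBase Q i = proj₁ (proj₂ (extension Q i))

  B₀─Q⊆completion : ∀ Q i → B₀ k ─ Q ⊆ completion Q i
  B₀─Q⊆completion Q i = proj₁ (proj₂ (proj₂ (extension Q i)))

  completion⊆ : ∀ Q i → completion Q i ⊆ (B₀ k ─ Q) ∪ Bint k i
  completion⊆ Q i = proj₂ (proj₂ (proj₂ (extension Q i)))

  B₀─completion≡Q : ∀ {Q i} → Q ⊆ B₀ k → (∀ {y} → y ∈ Q → y ∉ Bint k i) → B₀ k ─ completion Q i ≡ Q
  B₀─completion≡Q {Q} {i} Q⊆B₀ Q∩Bᵢ=∅ = ⊆-antisym ⊆Q Q⊆
    where
    ⊆Q : B₀ k ─ completion Q i ⊆ Q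
    ⊆Q {y} y∈ with y ∈? Q
    ... | yes y∈Q = y∈Q
    ... | no  y∉Q = contradiction (B₀─Q⊆completion Q i (x∈p∧x∉q⇒x∈p─q (p─q⊆p (B₀ k) _ y∈) y∉Q))
                                  (x∈p─q⇒x∉q (B₀ k) _ y∈)
    Q⊆ : Q ⊆ B₀ k ─ completion Q i
    Q⊆ {y} y∈Q = x∈p∧x∉q⇒x∈p─q (Q⊆B₀ y∈Q) y∉completion
      where
      y∉completion : y ∉ completion Q i
      y∉completion y∈ with x∈p∪q⁻ (B₀ k ─ Q) (Bint k i) (completion⊆ Q i y∈)
      ... | inj₁ y∈B₀─Q = x∈p─q⇒x∉q (B₀ k) Q y∈B₀─Q y∈Q
      ... | inj₂ y∈Bᵢ   = Q∩Bᵢ=∅ y∈Q y∈Bᵢ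

  completion-hasForm : ∀ {Q i} → Q ⊆ B₀ k → 1 ≤ toℕ i → HasForm k (completion Q i)
  completion-hasForm {Q} {i} Q⊆B₀ 1≤i =
    Q , B ─ (B₀ k ─ Q) , i , 1≤i , Q⊆B₀ , P⊆Bᵢ , p⊆q⇒q≡p∪[q─p] (B₀─Q⊆completion Q i)
    where
    B = completion Q i
    P⊆Bᵢ : B ─ (B₀ k ─ Q) ⊆ Bint k i
    P⊆Bᵢ y∈ with x∈p∪q⁻ (B₀ k ─ Q) (Bint k i) (completion⊆ Q i (p─q⊆p B _ y∈))
    ... | inj₁ y∈B₀─Q = contradiction y∈B₀─Q (x∈p─q⇒x∉q B _ y∈)
    ... | inj₂ y∈Bᵢ   = y∈Bᵢ

  ∣B₀─Q∣+∣Q∣≡k : ∀ {Q} → Q ⊆ B₀ k → ∣ B₀ k ─ Q ∣ + ∣ Q ∣ ≡ k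
  ∣B₀─Q∣+∣Q∣≡k {Q} Q⊆B₀ = begin
    ∣ B₀ k ─ Q ∣ + ∣ Q ∣          ≡⟨ cong (λ c → ∣ B₀ k ─ Q ∣ + ∣ c ∣) Q≡B₀∩Q ⟩
    ∣ B₀ k ─ Q ∣ + ∣ B₀ k ∩ Q ∣   ≡⟨ ∣p∣≡∣p─q∣+∣p∩q∣ (B₀ {suc n} k) Q ⟨
    ∣ B₀ {suc n} k ∣              ≡⟨ rank (B₀ k) B₀-isBase ⟩
    k                             ∎
    where
    open ≡-Reasoning
    Q≡B₀∩Q : Q ≡ B₀ k ∩ Q
    Q≡B₀∩Q = ⊆-antisym (λ y∈Q → x∈p∩q⁺ (Q⊆B₀ y∈Q , y∈Q)) (p∩q⊆q (B₀ k) Q)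

  completion-≡⇒k≤ : ∀ Q i j → completion Q i ≡ completion Q j →
                    k ≤ ∣ B₀ k ─ Q ∣ + ∣ Bint k i ∩ Bint k j ∣
  completion-≡⇒k≤ Q i j Bᵢ≡Bⱼ = begin
    k                                             ≡⟨ rank B (completion-isBase Q i) ⟨
    ∣ B ∣                                         ≤⟨ p⊆q⇒∣p∣≤∣q∣ B⊆ ⟩
    ∣ (B₀ k ─ Q) ∪ (Bint k i ∩ Bint k j) ∣        ≤⟨ ∣p∪q∣≤∣p∣+∣q∣ (B₀ k ─ Q) _ ⟩
    ∣ B₀ k ─ Q ∣ + ∣ Bint k i ∩ Bint k j ∣        ∎
    where
    open ≤-Reasoning
    B = completion Q i
    B⊆ : B ⊆ (B₀ k ─ Q) ∪ (Bint k i ∩ Bint k j)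
    B⊆ {y} y∈ with x∈p∪q⁻ _ _ (completion⊆ Q i y∈) | x∈p∪q⁻ _ _ (completion⊆ Q j (subst (y ∈_) Bᵢ≡Bⱼ y∈))
    ... | inj₁ y∈B₀─Q | _            = p⊆p∪q _ y∈B₀─Q
    ... | inj₂ _      | inj₁ y∈B₀─Q  = p⊆p∪q _ y∈B₀─Q
    ... | inj₂ y∈Bᵢ   | inj₂ y∈Bⱼ    = q⊆p∪q _ _ (x∈p∩q⁺ (y∈Bᵢ , y∈Bⱼ))

  Q : ℕ → List Bool → Subset (suc n)
  Q x T = pad (encode x T) (suc n)

  -- B₀ ∖ B is Q x T for the bases built below, from which decode reads (x, T) back.
  key : Subset (suc n) → ℕ × List Bool
  key B = decode (toList (B₀ k ─ B))

  -- The windows used for Q x T start at x + Δ + 1 + t (k − r + 1), as long as they do not wrap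
  -- around onto x.
  spacing : ℕ → ℕ
  spacing r = suc (k ∸ r)

  extraWindows : ℕ → ℕ → ℕ
  extraWindows Δ r = (suc n ∸ k ∸ Δ ∸ 1) / spacing r

  start : ℕ → ℕ → ℕ → ℕ → ℕ
  start Δ r x t = x + suc Δ + t * spacing r

  group : ℕ → ℕ → ℕ → List Bool → List (Subset (suc n))
  group Δ r x T = applyUpTo (λ t → completion (Q x T) (start Δ r x t mod suc n)) (extraWindows Δ r + 1)

  record Member (x : ℕ) (T : List Bool) (B : Subset (suc n)) : Set where
    field
      isBase  : IsBase B
      hasForm : HasForm k B
      key≡    : key B ≡ (x , T)
      removes : Nonempty (B₀ k ─ B)

  module Group {Δ r x T} (Δ<k⊓n∸k : Δ < k ⊓ (suc n ∸ k)) (1≤r : 1 ≤ r) (r≤1+Δ : r ≤ suc Δ)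
               (x<k∸Δ : x < k ∸ Δ) (T-pattern : Pattern Δ r T) where

    x+1+Δ≤k : x + suc Δ ≤ k
    x+1+Δ≤k = subst (_≤ k) (sym (+-suc x Δ)) (m≤o∸n⇒m+n≤o (suc x) (<⇒≤ (m<n⊓o⇒m<n k _ Δ<k⊓n∸k)) x<k∸Δ)

    1+Δ+k≤n : suc Δ + k ≤ suc n
    1+Δ+k≤n = m≤o∸n⇒m+n≤o (suc Δ) k≤n (m<n⊓o⇒m<o k _ Δ<k⊓n∸k)

    x<k : x < k
    x<k = ≤-trans (s≤s (m≤m+n x Δ)) (subst (_≤ k) (+-suc x Δ) x+1+Δ≤k)

    length-encode≤n : length (encode x T) ≤ suc n
    length-encode≤n = begin
      length (encode x T)   ≡⟨ length-encode x T ⟩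
      x + suc (length T)    ≡⟨ cong (λ l → x + suc l) (proj₁ T-pattern) ⟩
      x + suc Δ             ≤⟨ ≤-trans x+1+Δ≤k k≤n ⟩
      suc n                 ∎
      where open ≤-Reasoning

    Q-bounds : ∀ {y} → y ∈ Q x T → x ≤ toℕ y × toℕ y ≤ x + Δ
    Q-bounds {y} y∈Q with bit-encode (toℕ y) x T (trans (sym (lookup-pad (encode x T) (suc n) y)) ([]=⇒lookup y∈Q))
    ... | x≤y , y≤x+len = x≤y , subst (λ l → toℕ y ≤ x + l) (proj₁ T-pattern) y≤x+len

    Q⊆B₀ : Q x T ⊆ B₀ k
    Q⊆B₀ y∈Q = ∈B₀⁺ k (<-≤-trans (s≤s (proj₂ (Q-bounds y∈Q))) (subst (_≤ k) (+-suc x Δ) x+1+Δ≤k))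

    ∣Q∣≡r : ∣ Q x T ∣ ≡ r
    ∣Q∣≡r = trans (∣pad∣ (encode x T) (suc n) length-encode≤n) (trans (trues-encode x T) (proj₁ (proj₂ T-pattern)))

    x∈Q : x mod suc n ∈ Q x T
    x∈Q = lookup⇒[]= (x mod suc n) (Q x T) (begin
      Vec.lookup (Q x T) (x mod suc n)      ≡⟨ lookup-pad (encode x T) (suc n) (x mod suc n) ⟩
      bit (toℕ (x mod suc n)) (encode x T)  ≡⟨ cong (λ i → bit i (encode x T)) (toℕ-mod (<-≤-trans x<k k≤n)) ⟩
      bit x (encode x T)                    ≡⟨ bit-encode-start x T ⟩
      true                                  ∎)
      where open ≡-Reasoning

    module Window {t} (t≤extra : t ≤ extraWindows Δ r) where
      w = start Δ r x t
      i = w mod suc n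

      w+k≤n+x : w + k ≤ suc n + x
      w+k≤n+x = begin
        x + suc Δ + t * spacing r + k            ≤⟨ +-monoˡ-≤ k (+-monoʳ-≤ (x + suc Δ) t*s≤R) ⟩
        x + suc Δ + R + k                        ≡⟨ rearrange x (suc Δ) R k ⟩
        x + (R + (suc Δ + k))                    ≡⟨ cong (λ c → x + (c + (suc Δ + k))) R≡ ⟩
        x + (suc n ∸ (suc Δ + k) + (suc Δ + k))  ≡⟨ cong (x +_) (m∸n+n≡m 1+Δ+k≤n) ⟩
        x + suc n                                ≡⟨ +-comm x (suc n) ⟩
        suc n + x                                ∎
        where
        open ≤-Reasoning
        R = suc n ∸ k ∸ Δ ∸ 1
        t*s≤R : t * spacing r ≤ R
        t*s≤R = ≤-trans (*-monoˡ-≤ (spacing r) t≤extra) (m/n*n≤m R (spacing r))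
        R≡ : R ≡ suc n ∸ (suc Δ + k)
        R≡ = begin-equality
          suc n ∸ k ∸ Δ ∸ 1     ≡⟨ ∸-+-assoc (suc n ∸ k) Δ 1 ⟩
          suc n ∸ k ∸ (Δ + 1)   ≡⟨ ∸-+-assoc (suc n) k (Δ + 1) ⟩
          suc n ∸ (k + (Δ + 1)) ≡⟨ cong (suc n ∸_) (trans (+-comm k (Δ + 1)) (cong (_+ k) (+-comm Δ 1))) ⟩
          suc n ∸ (suc Δ + k)   ∎
        rearrange : ∀ a b c d → a + b + c + d ≡ a + (c + (b + d))
        rearrange = solve-∀

      toℕ-i : toℕ i ≡ w
      toℕ-i = toℕ-mod (+-cancelʳ-< k w (suc n) (≤-<-trans w+k≤n+x (+-monoʳ-< (suc n) x<k)))

      Q∩Bᵢ=∅ : ∀ {y} → y ∈ Q x T → y ∉ Bint k i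
      Q∩Bᵢ=∅ y∈Q y∈Bᵢ with Bint-avoids k i {x} {x + Δ} x+Δ<i i+k≤n+x y∈Bᵢ
        where
        x+Δ<i = subst (x + Δ <_) (sym toℕ-i) (≤-trans (≤-reflexive (sym (+-suc x Δ))) (m≤m+n (x + suc Δ) _))
        i+k≤n+x = subst (λ c → c + k ≤ suc n + x) (sym toℕ-i) w+k≤n+x
      ... | inj₁ y<x   = <⇒≱ y<x (proj₁ (Q-bounds y∈Q))
      ... | inj₂ x+Δ<y = <⇒≱ x+Δ<y (proj₂ (Q-bounds y∈Q))

      B = completion (Q x T) i

      member : Member x T B
      member = record
        { isBase  = completion-isBase (Q x T) i
        ; hasForm = completion-hasForm Q⊆B₀ 1≤i
        ; key≡    = key≡
        ; removes = x mod suc n , subst (x mod suc n ∈_) (sym B₀─B≡Q) x∈Q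
        }
        where
        B₀─B≡Q = B₀─completion≡Q Q⊆B₀ Q∩Bᵢ=∅
        1≤i = subst (1 ≤_) (sym toℕ-i) (≤-trans (s≤s z≤n) (≤-trans (m≤n+m (suc Δ) x) (m≤m+n _ _)))
        key≡ : key B ≡ (x , T)
        key≡ = begin
          decode (toList (B₀ k ─ B))        ≡⟨ cong (decode ∘ toList) B₀─B≡Q ⟩
          decode (toList (Q x T))           ≡⟨ cong decode (toList-pad (encode x T) (suc n) length-encode≤n) ⟩
          decode (encode x T List.++ _)     ≡⟨ decode-encode x T _ (proj₂ (proj₂ T-pattern)) ⟩
          x , T                             ∎
          where open ≡-Reasoning

    -- Both bases would lie in (B₀ ∖ Q) ∪ (Bᵢ ∩ Bⱼ), which has fewer than k elements.
    windows-apart : ∀ {t t′} (t≤ : t ≤ extraWindows Δ r) (t′≤ : t′ ≤ extraWindows Δ r) → t < t′ →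
                    Window.B t≤ ≢ Window.B t′≤
    windows-apart {t} {t′} t≤ t′≤ t<t′ Bₜ≡Bₜ′ = <-irrefl refl (begin-strict
      k                                        ≤⟨ completion-≡⇒k≤ (Q x T) i j Bₜ≡Bₜ′ ⟩
      ∣ B₀ k ─ Q x T ∣ + ∣ Bint k i ∩ Bint k j ∣ <⟨ +-monoʳ-< ∣ B₀ k ─ Q x T ∣ overlap<r ⟩
      ∣ B₀ k ─ Q x T ∣ + r                     ≡⟨ cong (∣ B₀ k ─ Q x T ∣ +_) (sym ∣Q∣≡r) ⟩
      ∣ B₀ k ─ Q x T ∣ + ∣ Q x T ∣             ≡⟨ ∣B₀─Q∣+∣Q∣≡k Q⊆B₀ ⟩
      k                                        ∎)
      where
      open ≤-Reasoning
      module W = Window t≤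
      module W′ = Window t′≤
      i = W.i
      j = W′.i
      w+s≤w′ : W.w + spacing r ≤ W′.w
      w+s≤w′ = begin
        x + suc Δ + t * spacing r + spacing r     ≡⟨ +-assoc (x + suc Δ) (t * spacing r) (spacing r) ⟩
        x + suc Δ + (t * spacing r + spacing r)   ≡⟨ cong (x + suc Δ +_) (+-comm (t * spacing r) (spacing r)) ⟩
        x + suc Δ + suc t * spacing r             ≤⟨ +-monoʳ-≤ (x + suc Δ) (*-monoˡ-≤ (spacing r) t<t′) ⟩
        x + suc Δ + t′ * spacing r                ∎
      overlap<r : ∣ Bint k i ∩ Bint k j ∣ < r
      overlap<r = begin-strict
        ∣ Bint k i ∩ Bint k j ∣                     ≤⟨ ∣Bint∩Bint∣≤ k i j i≤j j+k≤n+i ⟩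
        toℕ i + k ∸ toℕ j                           ≡⟨ cong₂ (λ a b → a + k ∸ b) W.toℕ-i W′.toℕ-i ⟩
        W.w + k ∸ W′.w                              ≤⟨ ∸-monoʳ-≤ (W.w + k) w+s≤w′ ⟩
        W.w + k ∸ (W.w + spacing r)                 ≡⟨ [m+n]∸[m+o]≡n∸o W.w k (spacing r) ⟩
        k ∸ spacing r                               <⟨ m∸[1+m∸n]<n 1≤r (≤-trans r≤1+Δ (≤-trans (m≤n+m (suc Δ) x) x+1+Δ≤k)) ⟩
        r                                           ∎
        where
        i≤j = subst₂ _≤_ (sym W.toℕ-i) (sym W′.toℕ-i) (≤-trans (m≤m+n W.w (spacing r)) w+s≤w′)
        j+k≤n+i = subst₂ (λ a b → a + k ≤ suc n + b) (sym W′.toℕ-i) (sym W.toℕ-i)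
                    (≤-trans W′.w+k≤n+x (+-monoʳ-≤ (suc n) (≤-trans (m≤m+n x (suc Δ)) (m≤m+n (x + suc Δ) _))))

    ≤extra : ∀ {t} → t < extraWindows Δ r + 1 → t ≤ extraWindows Δ r
    ≤extra {t} t< = ≤-pred (subst (t <_) (+-comm (extraWindows Δ r) 1) t<)

    members : All (Member x T) (group Δ r x T)
    members = All.applyUpTo⁺₁ _ (extraWindows Δ r + 1) (λ t< → Window.member (≤extra t<))

    group-unique : Unique (group Δ r x T)
    group-unique = Unique.applyUpTo⁺₁ _ (extraWindows Δ r + 1)
                     (λ t<t′ t′< → windows-apart (≤extra (<-trans t<t′ t′<)) (≤extra t′<) t<t′)

  groupsAt : ℕ → ℕ → ℕ → List (Subset (suc n))
  groupsAt Δ r x = concatMap (group Δ r x) (patterns Δ r)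

  groupsOfSize : ℕ → ℕ → List (Subset (suc n))
  groupsOfSize Δ r = concatMap (groupsAt Δ r) (upTo (k ∸ Δ))

  groupsOfWidth : ℕ → List (Subset (suc n))
  groupsOfWidth Δ = concatMap (groupsOfSize Δ) (map suc (upTo (suc Δ)))

  constructed : List (Subset (suc n))
  constructed = concatMap groupsOfWidth (upTo (k ⊓ (suc n ∸ k)))

  Built : ℕ → ℕ → Subset (suc n) → Set
  Built Δ r B = ∃[ x ] ∃[ T ] Pattern Δ r T × Member x T B

  module _ {Δ r} (Δ<k⊓n∸k : Δ < k ⊓ (suc n ∸ k)) (1≤r : 1 ≤ r) (r≤1+Δ : r ≤ suc Δ) where

    groupsAt-built : ∀ {x} → x < k ∸ Δ → All (λ B → ∃[ T ] Pattern Δ r T × Member x T B) (groupsAt Δ r x)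
    groupsAt-built {x} x<k∸Δ = All-concatMap⁺ (group Δ r x) (All.map (λ {T} pat →
      All.map (λ m → T , pat , m) (Group.members Δ<k⊓n∸k 1≤r r≤1+Δ x<k∸Δ pat)) (patterns-sound Δ r))

    groupsAt-unique : ∀ {x} → x < k ∸ Δ → Unique (groupsAt Δ r x)
    groupsAt-unique {x} x<k∸Δ = Unique-concatMap⁺ (proj₂ ∘ key) (group Δ r x) (patterns-unique Δ r)
      (All.map (λ {T} pat → Group.group-unique Δ<k⊓n∸k 1≤r r≤1+Δ x<k∸Δ pat ,
        All.map (cong proj₂ ∘ Member.key≡) (Group.members Δ<k⊓n∸k 1≤r r≤1+Δ x<k∸Δ pat)) (patterns-sound Δ r))

    groupsOfSize-built : All (Built Δ r) (groupsOfSize Δ r)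
    groupsOfSize-built = All-concatMap⁺ (groupsAt Δ r) (All.applyUpTo⁺₁ id (k ∸ Δ) (λ {x} x<k∸Δ →
      All.map (λ (T , pat , m) → x , T , pat , m) (groupsAt-built x<k∸Δ)))

    groupsOfSize-unique : Unique (groupsOfSize Δ r)
    groupsOfSize-unique = Unique-concatMap⁺ (proj₁ ∘ key) (groupsAt Δ r) (Unique.upTo⁺ (k ∸ Δ))
      (All.applyUpTo⁺₁ id (k ∸ Δ) (λ x<k∸Δ →
        groupsAt-unique x<k∸Δ , All.map (λ (_ , _ , m) → cong proj₁ (Member.key≡ m)) (groupsAt-built x<k∸Δ)))

  module _ {Δ} (Δ<k⊓n∸k : Δ < k ⊓ (suc n ∸ k)) where

    All-sizes : ∀ {P : ℕ → Set} → (∀ {r} → 1 ≤ r → r ≤ suc Δ → P r) → All P (map suc (upTo (suc Δ)))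
    All-sizes P-size = All.map⁺ (All.applyUpTo⁺₁ id (suc Δ) (P-size (s≤s z≤n)))

    groupsOfWidth-built : All (λ B → ∃[ r ] Built Δ r B) (groupsOfWidth Δ)
    groupsOfWidth-built = All-concatMap⁺ (groupsOfSize Δ) (All-sizes (λ {r} 1≤r r≤1+Δ →
      All.map (r ,_) (groupsOfSize-built Δ<k⊓n∸k 1≤r r≤1+Δ)))

    groupsOfWidth-unique : Unique (groupsOfWidth Δ)
    groupsOfWidth-unique = Unique-concatMap⁺ (suc ∘ trues ∘ proj₂ ∘ key) (groupsOfSize Δ)
      (Unique.map⁺ suc-injective (Unique.upTo⁺ (suc Δ)))
      (All-sizes (λ 1≤r r≤1+Δ → groupsOfSize-unique Δ<k⊓n∸k 1≤r r≤1+Δ ,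
        All.map (λ (_ , _ , pat , m) → trans (cong (suc ∘ trues ∘ proj₂) (Member.key≡ m)) (proj₁ (proj₂ pat)))
                (groupsOfSize-built Δ<k⊓n∸k 1≤r r≤1+Δ)))

  constructed-built : All (λ B → ∃[ Δ ] ∃[ r ] Built Δ r B) constructed
  constructed-built = All-concatMap⁺ groupsOfWidth (All.applyUpTo⁺₁ id (k ⊓ (suc n ∸ k)) (λ {Δ} Δ< →
    All.map (Δ ,_) (groupsOfWidth-built Δ<)))

  constructed-unique : Unique constructed
  constructed-unique = Unique-concatMap⁺ (length ∘ proj₂ ∘ key) groupsOfWidth (Unique.upTo⁺ (k ⊓ (suc n ∸ k)))
    (All.applyUpTo⁺₁ id (k ⊓ (suc n ∸ k)) (λ Δ< → groupsOfWidth-unique Δ< ,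
      All.map (λ (_ , _ , _ , pat , m) → trans (cong (length ∘ proj₂) (Member.key≡ m)) (proj₁ pat))
              (groupsOfWidth-built Δ<)))

  length-groupsOfSize : ∀ Δ r → length (groupsOfSize Δ r) ≡
    (k ∸ Δ) * binomℤ (ℤ.+ Δ ℤ.- ℤ.+ 1) (ℤ.+ r ℤ.- ℤ.+ 2) * (extraWindows Δ r + 1)
  length-groupsOfSize Δ r = begin
    length (groupsOfSize Δ r)                       ≡⟨ length-concatMap-const (groupsAt Δ r) (upTo (k ∸ Δ)) length-groupsAt ⟩
    length (upTo (k ∸ Δ)) * (length (patterns Δ r) * (extraWindows Δ r + 1))
                                                    ≡⟨ cong (_* (length (patterns Δ r) * (extraWindows Δ r + 1))) (length-upTo (k ∸ Δ)) ⟩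
    (k ∸ Δ) * (length (patterns Δ r) * (extraWindows Δ r + 1))
                                                    ≡⟨ *-assoc (k ∸ Δ) (length (patterns Δ r)) (extraWindows Δ r + 1) ⟨
    (k ∸ Δ) * length (patterns Δ r) * (extraWindows Δ r + 1)
                                                    ≡⟨ cong (λ c → (k ∸ Δ) * c * (extraWindows Δ r + 1)) (length-patterns Δ r) ⟩
    (k ∸ Δ) * binomℤ (ℤ.+ Δ ℤ.- ℤ.+ 1) (ℤ.+ r ℤ.- ℤ.+ 2) * (extraWindows Δ r + 1) ∎
    where
    open ≡-Reasoning
    length-groupsAt : ∀ x → length (groupsAt Δ r x) ≡ length (patterns Δ r) * (extraWindows Δ r + 1)
    length-groupsAt x = length-concatMap-const (group Δ r x) (patterns Δ r) (λ _ → length-applyUpTo _ _)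

  suc-length-constructed : suc (length constructed) ≡ m₁ (suc n) k
  suc-length-constructed = cong suc (trans (length-concatMap groupsOfWidth widths) (cong sum (map-cong (λ Δ →
    trans (length-concatMap (groupsOfSize Δ) (sizes Δ)) (cong sum (map-cong (length-groupsOfSize Δ) (sizes Δ)))) widths)))
    where
    widths = upTo (k ⊓ (suc n ∸ k))
    sizes : ℕ → List ℕ
    sizes Δ = map suc (upTo (suc Δ))

B₀-hasForm : ∀ {n} k (i : Fin n) → 1 ≤ toℕ i → HasForm k (B₀ {n} k)
B₀-hasForm k i 1≤i = ⊥ , ⊥ , i , 1≤i , ⊆-min (B₀ k) , ⊆-min (Bint k i) ,
                     sym (trans (∪-identityʳ (B₀ k ─ ⊥)) (p─⊥≡p (B₀ k)))

theorem3p5 : (n k : ℕ) → 2 ≤ n → (M : Matroid n) → IsCyclicMatroid k M →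
    ∃ λ (L : List (Subset n)) → Unique L ×
    All (λ B → Matroid.IsBase M B × HasForm k B) L × m₁ n k ≤ length L
theorem3p5 (suc (suc n)) k (s≤s (s≤s z≤n)) M CM =
  B₀ k ∷ constructed ,
  All.map (λ (_ , _ , _ , _ , _ , m) → Nonempty[p─q]⇒p≢q (Member.removes m)) constructed-built ∷ constructed-unique ,
  (B₀-isBase , B₀-hasForm k (Fin.suc Fin.zero) (s≤s z≤n)) ∷
    All.map (λ (_ , _ , _ , _ , _ , m) → Member.isBase m , Member.hasForm m) constructed-built ,
  ≤-reflexive (sym suc-length-constructed)
  where
  open Cyclic CM
  open Construction CM
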